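{- Let $\mathcal{K}$ be the set of all positions of misère partizan Kayles. Then $S_2\geqq S_1+S_1\pmod{\mathcal{K}}$ and $S_2\not\equiv S_1+S_1\pmod{\mathcal{K}}$ (i.e. $S_2 \gneqq S_1+S_1 \pmod{\mathcal{K}}$).
   Context: Partizan Kayles is played on $1\times n$ strips of squares; $S_n$ denotes an empty strip of length $n$. Left moves by placing a single square on one empty cell; Right moves by placing a domino covering two adjacent empty cells of the same strip; a placement splits a strip into the strips of empty cells on either side. $\mathcal{K}$ is the set of all disjunctive sums of strips. Under misère play a player unable to move on their turn wins. Outcomes $\mathcal{L},\mathcal{R},\mathcal{N},\mathcal{P}$ (Left wins always, Right wins always, first player wins, second player wins) are partially ordered by $\mathcal{L}>\mathcal{N}>\mathcal{R}$, $\mathcal{L}>\mathcal{P}>\mathcal{R}$; $o^-(G)$ is the misère outcome. $G\geqq H\pmod{\mathcal{K}}$ means $o^-(G+X)\ge o^-(H+X)$ for all $X\in\mathcal{K}$, and $G\equiv H\pmod{\mathcal{K}}$ means $o^-(G+X)=o^-(H+X)$ for all $X\in\mathcal{K}$. -}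

module Defs where

open import Data.Nat using (ℕ; zero; suc; _∸_; _+_)
open import Data.Bool using (Bool; true; false; not; _∨_)
open import Data.List using (List; []; _∷_; [_]; map; _++_; upTo; null)
open import Data.Bool.ListAction using (any)
open import Data.Nat.ListAction using (sum)
open import Data.Product using (_×_; _,_)

-- A position of partizan Kayles: a disjunctive sum of strips, given as the
-- list of lengths of its empty strips.  The set 𝒦 of all
-- positions is the type Position.
Position : Set
Position = List ℕ

S : ℕ → Position
S n = [ n ]

infixl 6 _⊕_
_⊕_ : Position → Position → Position
G ⊕ H = G ++ H

-- Left places a square on cell i (0-based) of a strip of length n,
-- leaving strips of lengths i and n-1-i.
leftSplits : ℕ → List (ℕ × ℕ)
leftSplits n = map (λ i → i , n ∸ suc i) (upTo n)

-- Right places a domino on cells i, i+1 (0 ≤ i ≤ n-2), leaving strips of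
-- lengths i and n-2-i.
rightSplits : ℕ → List (ℕ × ℕ)
rightSplits n = map (λ i → i , n ∸ 2 ∸ i) (upTo (n ∸ 1))

options : (ℕ → List (ℕ × ℕ)) → Position → List Position
options f [] = []
options f (n ∷ G) =
  map (λ { (a , b) → a ∷ b ∷ G }) (f n) ++ map (n ∷_) (options f G)

leftOptions rightOptions : Position → List Position
leftOptions  = options leftSplits
rightOptions = options rightSplits

-- Misère play with fuel (fuel = number of empty cells + 1 suffices, since
-- every move fills at least one cell).
-- leftWinsFirst k G : Left, moving first in G, wins under misère play.
-- rightWinsFirst k G : Right, moving first in G, wins under misère play.
leftWinsFirst rightWinsFirst : ℕ → Position → Bool
leftWinsFirst zero G = false
leftWinsFirst (suc k) G =
  null (leftOptions G) ∨ any (λ G′ → not (rightWinsFirst k G′)) (leftOptions G)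
rightWinsFirst zero G = false
rightWinsFirst (suc k) G =
  null (rightOptions G) ∨ any (λ G′ → not (leftWinsFirst k G′)) (rightOptions G)

data Outcome : Set where
  𝓛 𝓝 𝓟 𝓡 : Outcome

outcomeOf : Bool → Bool → Outcome
outcomeOf true  false = 𝓛
outcomeOf true  true  = 𝓝
outcomeOf false false = 𝓟
outcomeOf false true  = 𝓡

o⁻ : Position → Outcome
o⁻ G = outcomeOf (leftWinsFirst (suc (sum G)) G) (rightWinsFirst (suc (sum G)) G)

data _≥ₒ_ : Outcome → Outcome → Set where
  refl≥ : ∀ {o} → o ≥ₒ o
  𝓛≥𝓝 : 𝓛 ≥ₒ 𝓝
  𝓛≥𝓟 : 𝓛 ≥ₒ 𝓟
  𝓛≥𝓡 : 𝓛 ≥ₒ 𝓡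
  𝓝≥𝓡 : 𝓝 ≥ₒ 𝓡
  𝓟≥𝓡 : 𝓟 ≥ₒ 𝓡

open import Relation.Binary.PropositionalEquality using (_≡_)

_≧K_ : Position → Position → Set
G ≧K H = ∀ (X : Position) → o⁻ (G ⊕ X) ≥ₒ o⁻ (H ⊕ X)

_≡K_ : Position → Position → Set
G ≡K H = ∀ (X : Position) → o⁻ (G ⊕ X) ≡ o⁻ (H ⊕ X)

-- We show S (m+2) ⊕ X ≽ S 1 ⊕ S 1 ⊕ S m ⊕ X for all m and X, i.e. Left wins first in
-- the left side whenever she does in the right one, and Right dually, by induction on
-- the number of empty cells.  A Left move in S 1 ⊕ S 1 ⊕ S m ⊕ X is copied in
-- S (m+2) ⊕ X: a square on a 1-strip becomes a square on the second cell, a square on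
-- cell j of S m one on cell j+2.  A Right domino leaving S i ⊕ S r from S (m+2) is
-- copied by a domino on S m leaving S (i-2) ⊕ S r, or S 1 ⊕ S (r-2) when i = 1, or
-- nothing when i = r = 1.  The exceptions are dominoes at an edge of S (m+2): Right
-- then faces S 1 ⊕ S 1 ⊕ Z with Z a Left-first loss, and wins either because Z has
-- no room for a domino or by a domino at the edge of a long strip of Z.
module Submission where

open import Defs
open import Data.Bool using (Bool; true; false; not; T; _∨_)
open import Data.Bool.Properties using (T-∨)
open import Data.Bool.ListAction using (any)
open import Data.Empty using (⊥-elim)
open import Data.List using (List; []; _∷_; map; null)
open import Data.List.Membership.Propositional using (_∈_; _∉_; find; lose)
open import Data.List.Membership.Propositional.Properties
  using (∈-++⁺ˡ; ∈-++⁺ʳ; ∈-++⁻; ∈-map⁺; ∈-map⁻; ∈-upTo⁺; ∈-upTo⁻)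
open import Data.List.Relation.Unary.Any using (here)
open import Data.List.Relation.Unary.Any.Properties using (any⁺; any⁻)
open import Data.Nat using (ℕ; zero; suc; _+_; _∸_; _≤_; _<_; z≤n; s≤s)
open import Data.Nat.ListAction using (sum)
open import Data.Nat.Properties
open import Algebra.Properties.CommutativeSemigroup +-commutativeSemigroup
  using (x∙yz≈y∙xz)
open import Data.Product using (_×_; _,_; proj₁; proj₂; ∃-syntax)
open import Data.Sum using (_⊎_; inj₁; inj₂)
open import Data.Unit using (tt)
open import Function using (_∘_; case_of_; Equivalence)
open import Relation.Binary.PropositionalEquality
open import Relation.Nullary using (¬_)

T-not⁻ : ∀ {b} → T (not b) → ¬ T b
T-not⁻ {false} _ ()

T-not⁺ : ∀ {b} → ¬ T b → T (not b)
T-not⁺ {true}  ¬t = ¬t tt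
T-not⁺ {false} _  = tt

null⇒∉ : ∀ {A : Set} {xs : List A} {x} → T (null xs) → x ∉ xs
null⇒∉ {xs = []} _ ()

∉⇒null : ∀ {A : Set} {xs : List A} → (∀ {x} → x ∉ xs) → T (null xs)
∉⇒null {xs = []}    _  = tt
∉⇒null {xs = _ ∷ _} ∉xs = ∉xs (here refl)

data Player : Set where
  left right : Player

opponent : Player → Player
opponent left  = right
opponent right = left

pieceSize : Player → ℕ
pieceSize left  = 1
pieceSize right = 2

splitsOf : Player → ℕ → List (ℕ × ℕ)
splitsOf left  = leftSplits
splitsOf right = rightSplits

winsFirst : Player → ℕ → Position → Bool
winsFirst left  = leftWinsFirst
winsFirst right = rightWinsFirst

winsFirst-suc : ∀ p k G → winsFirst p (suc k) G ≡
  null (options (splitsOf p) G) ∨ any (not ∘ winsFirst (opponent p) k) (options (splitsOf p) G)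
winsFirst-suc left  k G = refl
winsFirst-suc right k G = refl

∈-leftSplits⁻ : ∀ {n a b} → (a , b) ∈ leftSplits n → suc (a + b) ≡ n
∈-leftSplits⁻ {suc n} ab∈ with a , a∈ , refl ← ∈-map⁻ (λ i → i , suc n ∸ suc i) ab∈ =
  cong suc (m+[n∸m]≡n (≤-pred (∈-upTo⁻ a∈)))

∈-leftSplits⁺ : ∀ a b → (a , b) ∈ leftSplits (suc (a + b))
∈-leftSplits⁺ a b = subst (λ c → (a , c) ∈ leftSplits (suc (a + b))) (m+n∸m≡n a b)
  (∈-map⁺ (λ i → i , suc (a + b) ∸ suc i) (∈-upTo⁺ (s≤s (m≤m+n a b))))

∈-rightSplits⁻ : ∀ {n a b} → (a , b) ∈ rightSplits n → suc (suc (a + b)) ≡ n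
∈-rightSplits⁻ {suc (suc n)} ab∈ with a , a∈ , refl ← ∈-map⁻ (λ i → i , n ∸ i) ab∈ =
  cong (suc ∘ suc) (m+[n∸m]≡n (≤-pred (∈-upTo⁻ a∈)))

∈-rightSplits⁺ : ∀ a b → (a , b) ∈ rightSplits (suc (suc (a + b)))
∈-rightSplits⁺ a b = subst (λ c → (a , c) ∈ rightSplits (suc (suc (a + b)))) (m+n∸m≡n a b)
  (∈-map⁺ (λ i → i , a + b ∸ i) (∈-upTo⁺ (s≤s (m≤m+n a b))))

∈-splitsOf⁻ : ∀ p {n a b} → (a , b) ∈ splitsOf p n → pieceSize p + (a + b) ≡ n
∈-splitsOf⁻ left  = ∈-leftSplits⁻
∈-splitsOf⁻ right = ∈-rightSplits⁻

∈-splitsOf⁺ : ∀ p a b → (a , b) ∈ splitsOf p (pieceSize p + (a + b))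
∈-splitsOf⁺ left  = ∈-leftSplits⁺
∈-splitsOf⁺ right = ∈-rightSplits⁺

data Move (p : Player) : Position → Position → Set where
  split : ∀ {n a b G} → pieceSize p + (a + b) ≡ n → Move p (n ∷ G) (a ∷ b ∷ G)
  skip  : ∀ {n G G′} → Move p G G′ → Move p (n ∷ G) (n ∷ G′)

Move⇒∈options : ∀ {p G G′} → Move p G G′ → G′ ∈ options (splitsOf p) G
Move⇒∈options {p} (split refl) = ∈-++⁺ˡ (∈-map⁺ _ (∈-splitsOf⁺ p _ _))
Move⇒∈options {p} (skip {n} mv) = ∈-++⁺ʳ _ (∈-map⁺ (n ∷_) (Move⇒∈options mv))

∈options⇒Move : ∀ {p} G {G′} → G′ ∈ options (splitsOf p) G → Move p G G′
∈options⇒Move {p} (n ∷ G) G′∈ with ∈-++⁻ (map _ (splitsOf p n)) G′∈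
... | inj₁ ∈splits with _ , ab∈ , refl ← ∈-map⁻ _ ∈splits = split (∈-splitsOf⁻ p ab∈)
... | inj₂ ∈skips  with _ , G″∈ , refl ← ∈-map⁻ (n ∷_) ∈skips = skip (∈options⇒Move G G″∈)

NoMove : Player → Position → Set
NoMove p G = ∀ {G′} → ¬ Move p G G′

noMove? : ∀ p G → NoMove p G ⊎ ∃[ G′ ] Move p G G′
noMove? p G with options (splitsOf p) G in eq
... | []     = inj₁ λ mv → case subst (_ ∈_) eq (Move⇒∈options mv) of λ ()
... | G′ ∷ _ = inj₂ (G′ , ∈options⇒Move G (subst (G′ ∈_) (sym eq) (here refl)))

Move-sum< : ∀ {p G G′} → Move p G G′ → sum G′ < sum G
Move-sum< {p} (split {a = a} {b} {G} refl) = begin-strict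
  a + (b + sum G)               ≡⟨ +-assoc a b (sum G) ⟨
  a + b + sum G                 <⟨ +-monoˡ-< (sum G) (m<n+m (a + b) (pieceSize>0 p)) ⟩
  pieceSize p + (a + b) + sum G ∎
  where
  open ≤-Reasoning
  pieceSize>0 : ∀ p → 0 < pieceSize p
  pieceSize>0 left  = s≤s z≤n
  pieceSize>0 right = s≤s z≤n
Move-sum< (skip {n} mv) = +-monoʳ-< n (Move-sum< mv)

winsFirst-suc⁻ : ∀ p {k G} → T (winsFirst p (suc k) G) →
  NoMove p G ⊎ ∃[ G′ ] (Move p G G′ × ¬ T (winsFirst (opponent p) k G′))
winsFirst-suc⁻ p {k} {G} w with Equivalence.to T-∨ (subst T (winsFirst-suc p k G) w)
... | inj₁ none = inj₁ (null⇒∉ none ∘ Move⇒∈options)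
... | inj₂ some with G′ , G′∈ , ¬w′ ← find (any⁻ _ _ some) =
  inj₂ (G′ , ∈options⇒Move G G′∈ , T-not⁻ ¬w′)

winsFirst-noMove : ∀ p {k G} → NoMove p G → T (winsFirst p (suc k) G)
winsFirst-noMove p {k} {G} none = subst T (sym (winsFirst-suc p k G))
  (Equivalence.from T-∨ (inj₁ (∉⇒null (none ∘ ∈options⇒Move G))))

winsFirst-move : ∀ p {k G G′} → Move p G G′ → ¬ T (winsFirst (opponent p) k G′) →
  T (winsFirst p (suc k) G)
winsFirst-move p {k} {G} mv ¬w′ = subst T (sym (winsFirst-suc p k G))
  (Equivalence.from T-∨ (inj₂ (any⁺ _ (lose (Move⇒∈options mv) (T-not⁺ ¬w′)))))

winsFirst-fuel : ∀ p {k k′ G} → sum G < k → sum G < k′ →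
  T (winsFirst p k G) → T (winsFirst p k′ G)
winsFirst-fuel p {suc k} {suc k′} lt lt′ w with winsFirst-suc⁻ p w
... | inj₁ none = winsFirst-noMove p none
... | inj₂ (_ , mv , ¬w′) = winsFirst-move p mv (¬w′ ∘ winsFirst-fuel (opponent p)
  (<-≤-trans (Move-sum< mv) (≤-pred lt′)) (<-≤-trans (Move-sum< mv) (≤-pred lt)))

record Wins (p : Player) (G : Position) : Set where
  constructor wins
  field winsFirst-enough : T (winsFirst p (suc (sum G)) G)
open Wins

Wins-noMove : ∀ {p G} → NoMove p G → Wins p G
Wins-noMove {p} none = wins (winsFirst-noMove p none)

Wins-move : ∀ {p G G′} → Move p G G′ → ¬ Wins (opponent p) G′ → Wins p G
Wins-move {p} mv ¬w′ =
  wins (winsFirst-move p mv (¬w′ ∘ wins ∘ winsFirst-fuel (opponent p) (Move-sum< mv) ≤-refl))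

Wins-elim : ∀ {p G} → Wins p G → NoMove p G ⊎ ∃[ G′ ] (Move p G G′ × ¬ Wins (opponent p) G′)
Wins-elim {p} (wins w) with winsFirst-suc⁻ p w
... | inj₁ none = inj₁ none
... | inj₂ (G′ , mv , ¬w′) =
  inj₂ (G′ , mv , ¬w′ ∘ winsFirst-fuel (opponent p) ≤-refl (Move-sum< mv) ∘ winsFirst-enough)

infix 4 _≃_
data _≃_ : Position → Position → Set where
  ≃-refl  : ∀ {G} → G ≃ G
  ≃-trans : ∀ {G H K} → G ≃ H → H ≃ K → G ≃ K
  prep    : ∀ n {G H} → G ≃ H → n ∷ G ≃ n ∷ H
  swap    : ∀ m n G → m ∷ n ∷ G ≃ n ∷ m ∷ G
  drop-0  : ∀ G → 0 ∷ G ≃ G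
  add-0   : ∀ G → G ≃ 0 ∷ G

≃-sym : ∀ {G H} → G ≃ H → H ≃ G
≃-sym ≃-refl        = ≃-refl
≃-sym (≃-trans r s) = ≃-trans (≃-sym s) (≃-sym r)
≃-sym (prep n r)    = prep n (≃-sym r)
≃-sym (swap m n G)  = swap n m G
≃-sym (drop-0 G)    = add-0 G
≃-sym (add-0 G)     = drop-0 G

≃-sum : ∀ {G H} → G ≃ H → sum G ≡ sum H
≃-sum ≃-refl        = refl
≃-sum (≃-trans r s) = trans (≃-sum r) (≃-sum s)
≃-sum (prep n r)    = cong (n +_) (≃-sum r)
≃-sum (swap m n G)  = x∙yz≈y∙xz m n (sum G)
≃-sum (drop-0 G)    = refl
≃-sum (add-0 G)     = refl

≃-simulates : ∀ {p G H G′} → G ≃ H → Move p G G′ → ∃[ H′ ] (Move p H H′ × G′ ≃ H′)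
≃-simulates ≃-refl mv = _ , mv , ≃-refl
≃-simulates (≃-trans r s) mv with _ , mv′ , r′ ← ≃-simulates r mv
                              with _ , mv″ , s′ ← ≃-simulates s mv′ = _ , mv″ , ≃-trans r′ s′
≃-simulates (prep _ r) (split eq) = _ , split eq , prep _ (prep _ r)
≃-simulates (prep n r) (skip mv) with _ , mv′ , r′ ← ≃-simulates r mv = _ , skip mv′ , prep n r′
≃-simulates (swap m n G) (split {a = a} {b} eq) =
  _ , skip (split eq) , ≃-trans (prep a (swap b n G)) (swap a n (b ∷ G))
≃-simulates (swap m n G) (skip (split {a = a} {b} eq)) =
  _ , split eq , ≃-trans (swap m a (b ∷ G)) (prep a (swap m b G))
≃-simulates (swap m n _) (skip (skip mv)) = _ , skip (skip mv) , swap m n _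
≃-simulates {left}  (drop-0 _) (split ())
≃-simulates {right} (drop-0 _) (split ())
≃-simulates (drop-0 _) (skip mv) = _ , mv , drop-0 _
≃-simulates (add-0 _) mv = _ , skip mv , add-0 _

NoMove-≃ : ∀ {p G H} → G ≃ H → NoMove p G → NoMove p H
NoMove-≃ r none mv = none (proj₁ (proj₂ (≃-simulates (≃-sym r) mv)))

winsFirst-≃ : ∀ p k {G H} → G ≃ H → T (winsFirst p k G) → T (winsFirst p k H)
winsFirst-≃ left  zero _ ()
winsFirst-≃ right zero _ ()
winsFirst-≃ p (suc k) r w with winsFirst-suc⁻ p w
... | inj₁ none = winsFirst-noMove p (NoMove-≃ r none)
... | inj₂ (_ , mv , ¬w′) with _ , mv′ , r′ ← ≃-simulates r mv =
  winsFirst-move p mv′ (¬w′ ∘ winsFirst-≃ (opponent p) k (≃-sym r′))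

Wins-≃ : ∀ {p G H} → G ≃ H → Wins p G → Wins p H
Wins-≃ {p} {G} {H} r (wins w) =
  wins (subst (λ s → T (winsFirst p (suc s) H)) (≃-sum r) (winsFirst-≃ p (suc (sum G)) r w))

Move-strip : ∀ {p G G′} → Move p G G′ → ∃[ a ] ∃[ b ] ∃[ Y ] (G ≃ pieceSize p + (a + b) ∷ Y)
Move-strip (split {a = a} {b} {G} refl) = a , b , G , ≃-refl
Move-strip (skip {n} mv) with a , b , Y , r ← Move-strip mv =
  a , b , n ∷ Y , ≃-trans (prep n r) (swap n _ Y)

𝓛-greatest : ∀ o → 𝓛 ≥ₒ o
𝓛-greatest 𝓛 = refl≥
𝓛-greatest 𝓝 = 𝓛≥𝓝
𝓛-greatest 𝓟 = 𝓛≥𝓟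
𝓛-greatest 𝓡 = 𝓛≥𝓡

𝓡-least : ∀ o → o ≥ₒ 𝓡
𝓡-least 𝓛 = 𝓛≥𝓡
𝓡-least 𝓝 = 𝓝≥𝓡
𝓡-least 𝓟 = 𝓟≥𝓡
𝓡-least 𝓡 = refl≥

outcomeOf-mono : ∀ {a b a′ b′} → (T a′ → T a) → (T b → T b′) → outcomeOf a b ≥ₒ outcomeOf a′ b′
outcomeOf-mono {true}  {false} _ _ = 𝓛-greatest _
outcomeOf-mono {a′ = false} {true} _ _ = 𝓡-least _
outcomeOf-mono {true}  {true}  {true}  {true}  _ _ = refl≥
outcomeOf-mono {false} {false} {false} {false} _ _ = refl≥
outcomeOf-mono {true}  {true}  {_}     {false} _ b⇒b′ = ⊥-elim (b⇒b′ tt)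
outcomeOf-mono {false} {true}  {_}     {false} _ b⇒b′ = ⊥-elim (b⇒b′ tt)
outcomeOf-mono {false} {_}     {true}  {_}     a′⇒a _ = ⊥-elim (a′⇒a tt)

infix 4 _≽_
_≽_ : Position → Position → Set
G ≽ H = (Wins left H → Wins left G) × (Wins right G → Wins right H)

≽⇒o⁻-≥ : ∀ {G H} → G ≽ H → o⁻ G ≥ₒ o⁻ H
≽⇒o⁻-≥ (left⇒ , right⇒) =
  outcomeOf-mono (winsFirst-enough ∘ left⇒ ∘ wins) (winsFirst-enough ∘ right⇒ ∘ wins)

≽-respʳ-≃ : ∀ {G H H′} → H ≃ H′ → G ≽ H → G ≽ H′
≽-respʳ-≃ r (left⇒ , right⇒) = left⇒ ∘ Wins-≃ (≃-sym r) , Wins-≃ r ∘ right⇒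

StripDominanceBelow : ℕ → Set
StripDominanceBelow N = ∀ m X → m + sum X < N → suc (suc m) ∷ X ≽ 1 ∷ 1 ∷ m ∷ X

split-bound : ∀ a b s {N} → suc (a + b) + s ≤ N → a + (b + s) < N
split-bound a b s = ≤-trans (s≤s (≤-reflexive (sym (+-assoc a b s))))

move-bound : ∀ {p} m {X X′ N} → Move p X X′ → m + sum X ≤ N → m + sum X′ < N
move-bound m mv = <-≤-trans (+-monoʳ-< m (Move-sum< mv))

-- For Z ≃ S (k+2) ⊕ Y, the domino at the edge leaves S 1 ⊕ S 1 ⊕ S k ⊕ Y, which by
-- induction is no better for Left than Z.
rightWins-1∷1∷ : ∀ {N Z} → StripDominanceBelow N → sum Z ≤ N → ¬ Wins left Z →
  Wins right (1 ∷ 1 ∷ Z)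
rightWins-1∷1∷ {N} {Z} ih bound ¬wZ with noMove? right Z
... | inj₁ none = Wins-noMove λ { (split ()) ; (skip (split ())) ; (skip (skip mv)) → none mv }
... | inj₂ (_ , mv) with a , b , Y , Z≃ ← Move-strip mv =
  Wins-≃ (prep 1 (prep 1 (≃-sym Z≃))) (Wins-move (skip (skip (split {a = 0} refl))) ¬wB′)
  where
  k+Y<N : a + b + sum Y < N
  k+Y<N = ≤-trans (n≤1+n _) (≤-trans (≤-reflexive (sym (≃-sum Z≃))) bound)
  ¬wB′ : ¬ Wins left (1 ∷ 1 ∷ 0 ∷ a + b ∷ Y)
  ¬wB′ = ¬wZ ∘ Wins-≃ (≃-sym Z≃) ∘ proj₁ (ih (a + b) Y k+Y<N)
             ∘ Wins-≃ (prep 1 (prep 1 (drop-0 _)))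

emptySplit-≃ : ∀ {a b} G → a + b ≡ 0 → a ∷ b ∷ G ≃ G
emptySplit-≃ {zero}  {zero}  G _ = ≃-trans (drop-0 _) (drop-0 G)
emptySplit-≃ {zero}  {suc _} _ ()
emptySplit-≃ {suc _}         _ ()

leftReply : ∀ {N m X B′} → StripDominanceBelow N → m + sum X ≤ N →
  Move left (1 ∷ 1 ∷ m ∷ X) B′ → ¬ Wins right B′ → Wins left (suc (suc m) ∷ X)
leftReply _ _ (split eq) ¬w =
  Wins-move (split refl) (¬w ∘ Wins-≃ (≃-sym (emptySplit-≃ _ (suc-injective eq))))
leftReply _ _ (skip (split eq)) ¬w =
  Wins-move (split refl) (¬w ∘ Wins-≃ (≃-sym (prep 1 (emptySplit-≃ _ (suc-injective eq)))))
leftReply {X = X} ih le (skip (skip (split {a = a} {b} refl))) ¬w =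
  Wins-move (split {a = suc (suc a)} refl) (¬w ∘ proj₂ (ih a (b ∷ X) (split-bound a b (sum X) le)))
leftReply {m = m} ih le (skip (skip (skip mv))) ¬w =
  Wins-move (skip mv) (¬w ∘ proj₂ (ih m _ (move-bound m mv le)))

rightReplyToSplit : ∀ {N i r X} → StripDominanceBelow N → i + r + sum X ≤ N →
  ¬ Wins left (i ∷ r ∷ X) → Wins right (1 ∷ 1 ∷ i + r ∷ X)
rightReplyToSplit {i = zero} ih le ¬w = rightWins-1∷1∷ ih le (¬w ∘ Wins-≃ (add-0 _))
rightReplyToSplit {i = suc (suc j)} {r} {X} ih le ¬w =
  Wins-move (skip (skip (split {a = j} refl)))
    (¬w ∘ proj₁ (ih j (r ∷ X) (split-bound j r (sum X) (≤-trans (n≤1+n _) le))))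
rightReplyToSplit {i = 1} {zero} {X} ih le ¬w =
  rightWins-1∷1∷ ih le (¬w ∘ Wins-≃ (prep 1 (add-0 X)))
rightReplyToSplit {i = 1} {1} {X} ih le ¬w =
  Wins-move (skip (skip (split {a = 0} {b = 0} refl)))
    (¬w ∘ Wins-≃ (prep 1 (prep 1 (emptySplit-≃ X refl))))
rightReplyToSplit {i = 1} {suc (suc k)} {X} ih le ¬w =
  Wins-move (skip (skip (split {a = 1} {b = k} refl)))
    (¬w ∘ Wins-≃ (swap _ 1 X) ∘ proj₁ (ih k (1 ∷ X) k+1+X<N) ∘ Wins-≃ (prep 1 (prep 1 (swap 1 k X))))
  where
  k+1+X<N : k + (1 + sum X) < _
  k+1+X<N = ≤-trans (≤-reflexive (cong suc (+-suc k (sum X)))) (≤-trans (n≤1+n _) le)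

rightReply : ∀ {N m X A′} → StripDominanceBelow N → m + sum X ≤ N →
  Move right (suc (suc m) ∷ X) A′ → ¬ Wins left A′ → Wins right (1 ∷ 1 ∷ m ∷ X)
rightReply ih le (split refl) ¬w = rightReplyToSplit ih le ¬w
rightReply {m = m} ih le (skip mv) ¬w =
  Wins-move (skip (skip (skip mv))) (¬w ∘ proj₁ (ih m _ (move-bound m mv le)))

stripDominance-suc : ∀ {N} → StripDominanceBelow N → StripDominanceBelow (suc N)
stripDominance-suc ih m X (s≤s le) = leftWins , rightWins
  where
  leftWins : Wins left (1 ∷ 1 ∷ m ∷ X) → Wins left (suc (suc m) ∷ X)
  leftWins w with Wins-elim w
  ... | inj₁ none = ⊥-elim (none (split {a = 0} {b = 0} refl))
  ... | inj₂ (_ , mv , ¬w′) = leftReply ih le mv ¬w′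
  rightWins : Wins right (suc (suc m) ∷ X) → Wins right (1 ∷ 1 ∷ m ∷ X)
  rightWins w with Wins-elim w
  ... | inj₁ none = ⊥-elim (none (split {a = 0} refl))
  ... | inj₂ (_ , mv , ¬w′) = rightReply ih le mv ¬w′

stripDominance : ∀ N → StripDominanceBelow N
stripDominance zero _ _ ()
stripDominance (suc N) = stripDominance-suc (stripDominance N)

strip-≽ : ∀ m X → suc (suc m) ∷ X ≽ 1 ∷ 1 ∷ m ∷ X
strip-≽ m X = stripDominance (suc (m + sum X)) m X ≤-refl

corollary2p4 : (S 2 ≧K (S 1 ⊕ S 1)) × ¬ (S 2 ≡K (S 1 ⊕ S 1))
corollary2p4 = (λ X → ≽⇒o⁻-≥ (≽-respʳ-≃ (prep 1 (prep 1 (drop-0 X))) (strip-≽ 0 X)))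
             , λ ≡K → case ≡K [] of λ ()   -- o⁻ (S 2) is 𝓟, o⁻ (S 1 ⊕ S 1) is 𝓡
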